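{- For partial orders $\langle R,X\rangle$ and $\langle S,Y\rangle$ with $X\cap Y=\emptyset$, $P(\langle R,X\rangle+\langle S,Y\rangle)=P\langle R,X\rangle+P\langle S,Y\rangle$, where the $+$ on the right is the (partial-order) shuffle sum of relationships.
   Context: A relation is a pair $\langle R,X\rangle$ with $R\subseteq X^2$; partial orders are strict (irreflexive and transitive). For $X\cap Y=\emptyset$, $\langle R,X\rangle+\langle S,Y\rangle=\langle R\cup S,X\cup Y\rangle$. A relationship on $X$ is a pair $[U,X]$ with $U\subseteq\mathcal P(X^2)$. For a partial order, $P\langle R,X\rangle=[\{R'\subseteq X^2\mid R\subseteq R',\ \langle R',X\rangle\text{ a partial order}\},X]$. For relationships $[U,X],[V,Y]$ with $X\cap Y=\emptyset$, the shuffle sum is $[U,X]+[V,Y]=[\{Q\subseteq(X\cup Y)^2\mid \langle Q,X\cup Y\rangle\text{ a partial order and }\exists R\in U\,\exists S\in V\,(Q\cap X^2=R\ \&\ Q\cap Y^2=S)\},X\cup Y]$. -}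

module Defs where

open import Level using (Level)
open import Data.Product using (Σ; _×_; _,_)
open import Data.Sum using (_⊎_)
open import Data.Empty using (⊥)
open import Relation.Nullary using (¬_)
open import Function.Bundles using (_⇔_)

-- Subsets of a fixed ambient type A are predicates; relations R ⊆ A² are
-- binary predicates. A relation ⟨R,X⟩ is the pair (R , X) with R ⊆ X².
Subset : Set → Set₁
Subset A = A → Set

BinRel : Set → Set₁
BinRel A = A → A → Set

module _ {A : Set} where

  _⊆²_ : BinRel A → Subset A → Set
  R ⊆² X = ∀ a b → R a b → X a × X b

  _⊆ʳ_ : BinRel A → BinRel A → Set
  R ⊆ʳ R' = ∀ a b → R a b → R' a b

  RestrictEq : BinRel A → Subset A → BinRel A → Set
  RestrictEq Q X R = ∀ a b → (Q a b × X a × X b) ⇔ R a b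

  Disjoint : Subset A → Subset A → Set
  Disjoint X Y = ∀ a → X a → Y a → ⊥

  _∪ˢ_ : Subset A → Subset A → Subset A
  (X ∪ˢ Y) a = X a ⊎ Y a

  _∪ʳ_ : BinRel A → BinRel A → BinRel A
  (R ∪ʳ S) a b = R a b ⊎ S a b

  IsPartialOrder : BinRel A → Subset A → Set
  IsPartialOrder R X =
    (R ⊆² X) × (∀ a → ¬ R a a) × (∀ a b c → R a b → R b c → R a c)

  -- A relationship [U,X]: U ⊆ P(X²), represented by its membership predicate
  -- together with the carrier X.
  record Relationship : Set₂ where
    constructor [_,_]
    field
      members : BinRel A → Set₁
      carrier : Subset A
  open Relationship public

  relSum : BinRel A → Subset A → BinRel A → Subset A → BinRel A × Subset A
  relSum R X S Y = (R ∪ʳ S , X ∪ˢ Y)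

  P : BinRel A × Subset A → Relationship
  P (R , X) = [ (λ R' → Lift' ((R' ⊆² X) × (R ⊆ʳ R') × IsPartialOrder R' X)) , X ]
    where
      Lift' : Set → Set₁
      Lift' B = Level.Lift (Level.suc Level.zero) B

  shuffle : Relationship → Relationship → Relationship
  shuffle [ U , X ] [ V , Y ] =
    [ (λ Q → (Level.Lift (Level.suc Level.zero) ((Q ⊆² (X ∪ˢ Y)) × IsPartialOrder Q (X ∪ˢ Y)))
             × Σ (BinRel A) (λ R → U R × Σ (BinRel A) (λ S → V S
                 × Level.Lift (Level.suc Level.zero) (RestrictEq Q X R × RestrictEq Q Y S))))
    , X ∪ˢ Y ]

  _≈ᴿ_ : Relationship → Relationship → Set₁
  [ U , X ] ≈ᴿ [ V , Y ] = (∀ a → X a ⇔ Y a) × (∀ Q → U Q ⇔ V Q)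

module Submission where

-- Both sides have carrier X ∪ Y, so only the sets of relations
-- need to be compared. A relation Q lies in P(⟨R,X⟩ + ⟨S,Y⟩) iff Q is a
-- partial order on X ∪ Y extending R ∪ S. Such a Q lies in the shuffle sum,
-- witnessed by its restrictions Q ∩ X² and Q ∩ Y²: restricting a partial
-- order gives a partial order, and Q ∩ X² still contains R because R ⊆ X².
-- Conversely, if Q is a partial order on X ∪ Y with Q ∩ X² = R' ⊇ R and
-- Q ∩ Y² = S' ⊇ S, then every R- or S-pair lies in Q, so Q extends R ∪ S.

open import Defs
open import Data.Product using (_,_; _×_; proj₁; proj₂)
open import Data.Sum using (inj₁; inj₂)
open import Function.Bundles using (mk⇔; Equivalence)
open import Level using (lift)

module _ {A : Set} where

  IsExtensionOn : BinRel A → Subset A → BinRel A → Set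
  IsExtensionOn R X R' = (R' ⊆² X) × (R ⊆ʳ R') × IsPartialOrder R' X

  restrict : BinRel A → Subset A → BinRel A
  restrict Q X a b = Q a b × X a × X b

  restrict-restrictEq : (Q : BinRel A) (X : Subset A) → RestrictEq Q X (restrict Q X)
  restrict-restrictEq Q X a b = mk⇔ (λ q → q) (λ q → q)

  restrict-⊆² : (Q : BinRel A) (X : Subset A) → restrict Q X ⊆² X
  restrict-⊆² Q X a b = proj₂

  restrict-isPartialOrder : (Q : BinRel A) (X Z : Subset A) →
    IsPartialOrder Q Z → IsPartialOrder (restrict Q X) X
  restrict-isPartialOrder Q X Z (_ , irrefl , trans) =
    restrict-⊆² Q X ,
    (λ a qaa → irrefl a (proj₁ qaa)) ,
    (λ a b c (qab , xa , _) (qbc , _ , xc) → trans a b c qab qbc , xa , xc)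

  ⊆-restrict : (R Q : BinRel A) (X : Subset A) → R ⊆² X → R ⊆ʳ Q → R ⊆ʳ restrict Q X
  ⊆-restrict R Q X R⊆X² R⊆Q a b r = R⊆Q a b r , R⊆X² a b r

  ⊆-of-restrictEq : (Q R R' : BinRel A) (X : Subset A) →
    RestrictEq Q X R' → R ⊆ʳ R' → R ⊆ʳ Q
  ⊆-of-restrictEq Q R R' X Q∩X²≡R' R⊆R' a b r =
    proj₁ (Equivalence.from (Q∩X²≡R' a b) (R⊆R' a b r))

  ∪ʳ-least : (R S Q : BinRel A) → R ⊆ʳ Q → S ⊆ʳ Q → (R ∪ʳ S) ⊆ʳ Q
  ∪ʳ-least R S Q R⊆Q S⊆Q a b (inj₁ r) = R⊆Q a b r
  ∪ʳ-least R S Q R⊆Q S⊆Q a b (inj₂ s) = S⊆Q a b s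

  restrict-isExtension : (R Q : BinRel A) (X Z : Subset A) →
    R ⊆² X → R ⊆ʳ Q → IsPartialOrder Q Z → IsExtensionOn R X (restrict Q X)
  restrict-isExtension R Q X Z R⊆X² R⊆Q po =
    restrict-⊆² Q X , ⊆-restrict R Q X R⊆X² R⊆Q , restrict-isPartialOrder Q X Z po

  P-sum⊆shuffle : (R : BinRel A) (X : Subset A) (S : BinRel A) (Y : Subset A) →
    R ⊆² X → S ⊆² Y → (Q : BinRel A) →
    members (P (relSum R X S Y)) Q → members (shuffle (P (R , X)) (P (S , Y))) Q
  P-sum⊆shuffle R X S Y R⊆X² S⊆Y² Q (lift (Q⊆² , R∪S⊆Q , po)) =
    lift (Q⊆² , po) ,
    restrict Q X , lift (restrict-isExtension R Q X (X ∪ˢ Y) R⊆X² (λ a b r → R∪S⊆Q a b (inj₁ r)) po) ,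
    restrict Q Y , lift (restrict-isExtension S Q Y (X ∪ˢ Y) S⊆Y² (λ a b s → R∪S⊆Q a b (inj₂ s)) po) ,
    lift (restrict-restrictEq Q X , restrict-restrictEq Q Y)

  shuffle⊆P-sum : (R : BinRel A) (X : Subset A) (S : BinRel A) (Y : Subset A) →
    (Q : BinRel A) →
    members (shuffle (P (R , X)) (P (S , Y))) Q → members (P (relSum R X S Y)) Q
  shuffle⊆P-sum R X S Y Q
    (lift (Q⊆² , po) , R' , lift (_ , R⊆R' , _) , S' , lift (_ , S⊆S' , _) , lift (Q∩X²≡R' , Q∩Y²≡S')) =
    lift (Q⊆² , ∪ʳ-least R S Q (⊆-of-restrictEq Q R R' X Q∩X²≡R' R⊆R')
                               (⊆-of-restrictEq Q S S' Y Q∩Y²≡S' S⊆S') , po)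

proposition4p2 : {A : Set} (R : BinRel A) (X : Subset A) (S : BinRel A) (Y : Subset A) →
    IsPartialOrder R X → IsPartialOrder S Y → Disjoint X Y →
    P (relSum R X S Y) ≈ᴿ shuffle (P (R , X)) (P (S , Y))
proposition4p2 R X S Y (R⊆X² , _) (S⊆Y² , _) _ =
  (λ a → mk⇔ (λ x → x) (λ x → x)) ,
  (λ Q → mk⇔ (P-sum⊆shuffle R X S Y R⊆X² S⊆Y² Q) (shuffle⊆P-sum R X S Y Q))
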